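{- Let $z:[n]\to[k]$ be any map and let $\gamma\in\ker_{\mathbb Z}A_{n,z}$ be nonzero. Then there exist two edges $uv,u'v'$ of $K_n$ that are non-intersecting in the standard convex embedding of $K_n$ such that $x_{uv}x_{u'v'}$ divides $x^{\gamma^+}$ or $x^{\gamma^- }$.
   Context: Coordinates of $\mathbb Z^{\binom n2}$ and variables $x_{uv}$ are indexed by 2-subsets $\{u,v\}$ of $[n]$; $\gamma^\pm=\max(\pm\gamma,0)$ entrywise and $x^\alpha=\prod x_{uv}^{\alpha_{uv}}$. $A_{n,z}$ is the matrix obtained by stacking the vertex-edge incidence matrix of $K_n$ on top of the $\binom{k+1}2\times\binom n2$ matrix whose rows are indexed by pairs $(i,j)$, $1\le i\le j\le k$, and whose column $\{u,v\}$ has a single $1$ in row $(\min(z(u),z(v)),\max(z(u),z(v)))$. The standard convex embedding of $K_n$ places vertex $i$ at the $i$-th vertex (clockwise) of a regular $n$-gon in the plane, with edges drawn as straight segments; two edges are non-intersecting if their segments are disjoint (in particular they share no endpoint). -}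

module Defs where

open import Data.Nat using (ℕ; zero; suc)
import Data.Nat as ℕ
open import Data.Integer as ℤ using (ℤ; +_; -[1+_])
open import Data.Fin using (Fin; toℕ; _<_; _≤_)
open import Data.Fin.Properties using (_≟_; _<?_; _≤?_)
open import Data.List using (List; []; _∷_; concatMap; filter; map; foldr)
open import Data.List.Base using (allFin)
open import Data.Product using (Σ; Σ-syntax; _×_; _,_; proj₁; proj₂)
open import Data.Sum using (_⊎_)
open import Relation.Nullary using (Dec; yes; no; ¬_)
open import Relation.Nullary.Decidable using (_⊎-dec_; _×-dec_)
open import Relation.Binary.PropositionalEquality using (_≡_)

-- Edges of K_n : 2-subsets {u,v} of [n], represented as (u , v) with u < v.

Edge : ℕ → Set
Edge n = Σ[ p ∈ Fin n × Fin n ] proj₁ p < proj₂ p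

src : ∀ {n} → Edge n → Fin n
src ((u , _) , _) = u

tgt : ∀ {n} → Edge n → Fin n
tgt ((_ , v) , _) = v

edges : (n : ℕ) → List (Edge n)
edges n = concatMap (λ u → concatMap (λ v → pick u v) (allFin n)) (allFin n)
  where
  pick : Fin n → Fin n → List (Edge n)
  pick u v with u <? v
  ... | yes u<v = ((u , v) , u<v) ∷ []
  ... | no _    = []

_≟E_ : ∀ {n} (e f : Edge n) → Dec ((src e ≡ src f) × (tgt e ≡ tgt f))
e ≟E f = (src e ≟ src f) ×-dec (tgt e ≟ tgt f)

sumℤ : List ℤ → ℤ
sumℤ = foldr ℤ._+_ (+ 0)

Vec2 : ℕ → Set
Vec2 n = Edge n → ℤ

Incident : ∀ {n} → Fin n → Edge n → Set
Incident w e = (w ≡ src e) ⊎ (w ≡ tgt e)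

incident? : ∀ {n} (w : Fin n) (e : Edge n) → Dec (Incident w e)
incident? w e = (w ≟ src e) ⊎-dec (w ≟ tgt e)

minF : ∀ {k} → Fin k → Fin k → Fin k
minF a b with a ≤? b
... | yes _ = a
... | no _  = b

maxF : ∀ {k} → Fin k → Fin k → Fin k
maxF a b with a ≤? b
... | yes _ = b
... | no _  = a

-- column {u,v} of the lower block has its 1 in row (min(z u,z v), max(z u,z v))
ColourRow : ∀ {n k} → (Fin n → Fin k) → Fin k → Fin k → Edge n → Set
ColourRow z i j e =
  (minF (z (src e)) (z (tgt e)) ≡ i) × (maxF (z (src e)) (z (tgt e)) ≡ j)

colourRow? : ∀ {n k} (z : Fin n → Fin k) (i j : Fin k) (e : Edge n) →
             Dec (ColourRow z i j e)
colourRow? z i j e =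
  (minF (z (src e)) (z (tgt e)) ≟ i) ×-dec (maxF (z (src e)) (z (tgt e)) ≟ j)

-- γ ∈ ker_ℤ A_{n,z}: every row of A_{n,z} (vertex rows of the incidence
-- matrix of K_n, and rows (i,j) with i ≤ j) has zero inner product with γ.
InKernel : ∀ n k → (Fin n → Fin k) → Vec2 n → Set
InKernel n k z γ =
  ((w : Fin n) → sumℤ (map γ (filter (incident? w) (edges n))) ≡ + 0)
  × ((i j : Fin k) → i ≤ j →
       sumℤ (map γ (filter (colourRow? z i j) (edges n))) ≡ + 0)

Monomial : ℕ → Set
Monomial n = Edge n → ℕ

_∣ᵐ_ : ∀ {n} → Monomial n → Monomial n → Set
α ∣ᵐ β = ∀ e → α e ℕ.≤ β e

var : ∀ {n} → Edge n → Monomial n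
var e f with e ≟E f
... | yes _ = 1
... | no _  = 0

_*ᵐ_ : ∀ {n} → Monomial n → Monomial n → Monomial n
(α *ᵐ β) e = α e ℕ.+ β e

pos : ℤ → ℕ
pos (+ m)    = m
pos -[1+ _ ] = 0

neg : ℤ → ℕ
neg (+ _)    = 0
neg -[1+ m ] = suc m

_⁺ : ∀ {n} → Vec2 n → Monomial n
(γ ⁺) e = pos (γ e)

_⁻ : ∀ {n} → Vec2 n → Monomial n
(γ ⁻) e = neg (γ e)

-- Vertices lie in (clockwise) cyclic order 0,1,...,n-1 on a convex polygon.
-- Two chords with four distinct endpoints cross iff their endpoints
-- interleave in this cyclic order; with u<v and u'<v' this is
-- u < u' < v < v'  or  u' < u < v' < v.

Crossing : ∀ {n} → Edge n → Edge n → Set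
Crossing e f =
  (src e < src f × src f < tgt e × tgt e < tgt f)
  ⊎ (src f < src e × src e < tgt f × tgt f < tgt e)

NonIntersecting : ∀ {n} → Edge n → Edge n → Set
NonIntersecting e f =
  ¬ (src e ≡ src f) × ¬ (src e ≡ tgt f) × ¬ (tgt e ≡ src f) × ¬ (tgt e ≡ tgt f)
  × ¬ Crossing e f

-- Suppose the edges on which
-- γ is positive pairwise meet, and likewise those on which it is negative.
-- Take a support edge e = uβ (u < β) with β least, say γ_e > 0. No
-- negative edge u′β exists: balancing γ at min(u, u′) yields an edge
-- leaving it beyond β with the sign of the edge at max(u, u′), and the two
-- are nested. Now cut the vertices into [0, β] and (β, n). As every vertex
-- sum vanishes, telescoping over the cut point shows that γ has the same
-- total on the edges inside either part. Inside [0, β] lies e but no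
-- negative edge; inside (β, n) no positive edge, as it would lie beside e.
-- So the left total is positive and the right one is not; hence γ = 0.
module Submission where

open import Defs
open import Data.Nat using (ℕ)
open import Data.Integer using (+_)
open import Data.Fin using (Fin)
open import Data.Product using (Σ-syntax; _×_)
open import Data.Sum using (_⊎_)
open import Relation.Nullary using (¬_)
open import Relation.Binary.PropositionalEquality using (_≡_)

open import Level using (0ℓ)
open import Function using (_∘_; _⇔_; mk⇔; id; Equivalence)
open import Data.Empty using (⊥; ⊥-elim)
open import Data.Nat using (zero; suc; z≤n)
import Data.Nat as ℕ
import Data.Nat.Properties as ℕP
open import Data.Integer using (ℤ; -[1+_]; -_)
import Data.Integer as ℤ
import Data.Integer.Properties as ℤP
open import Data.Integer.Tactic.RingSolver using (solve-∀)
open import Data.Fin using (toℕ; fromℕ<; _<_; _≤_)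
import Data.Fin.Properties as FinP
open import Data.List using ([]; _∷_; map; filter)
open import Data.List.Properties using (filter-all; filter-none)
open import Data.List.Membership.Propositional using (_∈_; lose)
open import Data.List.Membership.Propositional.Properties
  using (∈-concatMap⁺; ∈-allFin; ∈-filter⁺)
open import Data.List.Relation.Unary.Any using (here; there; any?; satisfied)
open import Data.List.Relation.Unary.All using (All; []; _∷_; tabulate)
import Data.List.Relation.Unary.All as All
open import Data.List.Relation.Unary.All.Properties using (all-filter)
open import Data.List.Extrema ℕP.≤-totalOrder using (argmin; argmin-all; f[argmin]≤f[xs])
open import Data.Product using (Σ; _,_; proj₁; proj₂)
open import Data.Sum using (inj₁; inj₂; [_,_])
import Data.Sum as Sum
open import Relation.Nullary using (Dec; yes; no; ¬?)
open import Relation.Nullary.Decidable using (_×-dec_; _⊎-dec_; map′; decidable-stable)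
open import Relation.Unary using (Pred; Decidable)
open import Relation.Binary using (tri<; tri≈; tri>)
open import Relation.Binary.PropositionalEquality
  using (refl; sym; trans; cong; cong₂; subst; module ≡-Reasoning)

module _ {A : Set} (f : A → ℤ) where

  sum-neg : ∀ xs → sumℤ (map (-_ ∘ f) xs) ≡ - sumℤ (map f xs)
  sum-neg []       = refl
  sum-neg (x ∷ xs) =
    trans (cong (ℤ._+_ (- f x)) (sum-neg xs)) (sym (ℤP.neg-distrib-+ (f x) _))

  sum-nonneg : ∀ {xs} → All (λ x → + 0 ℤ.≤ f x) xs → + 0 ℤ.≤ sumℤ (map f xs)
  sum-nonneg []       = ℤP.≤-refl
  sum-nonneg (p ∷ ps) = ℤP.+-mono-≤ p (sum-nonneg ps)

  sum-nonpos : ∀ {xs} → All (λ x → f x ℤ.≤ + 0) xs → sumℤ (map f xs) ℤ.≤ + 0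
  sum-nonpos []       = ℤP.≤-refl
  sum-nonpos (p ∷ ps) = ℤP.+-mono-≤ p (sum-nonpos ps)

  sum-pos : ∀ {xs x} → All (λ x → + 0 ℤ.≤ f x) xs → x ∈ xs → + 0 ℤ.< f x →
            + 0 ℤ.< sumℤ (map f xs)
  sum-pos (_ ∷ ps) (here refl) 0<fx = ℤP.+-mono-<-≤ 0<fx (sum-nonneg ps)
  sum-pos (p ∷ ps) (there x∈)  0<fx = ℤP.+-mono-≤-< p (sum-pos ps x∈ 0<fx)

  module _ {P Q R : Pred A 0ℓ}
           (P? : Decidable P) (Q? : Decidable Q) (R? : Decidable R)
           (P⇔Q⊎R : ∀ {x} → P x ⇔ (Q x ⊎ R x)) (Q⇒¬R : ∀ {x} → Q x → ¬ R x) where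

    open Equivalence

    sum-filter-⊎ : ∀ xs → sumℤ (map f (filter P? xs)) ≡
                         sumℤ (map f (filter Q? xs)) ℤ.+ sumℤ (map f (filter R? xs))
    sum-filter-⊎ []       = refl
    sum-filter-⊎ (x ∷ xs) with P? x | Q? x | R? x
    ... | yes _  | yes _  | no _   =
      trans (cong (ℤ._+_ (f x)) (sum-filter-⊎ xs)) (sym (ℤP.+-assoc (f x) _ _))
    ... | yes _  | no _   | yes _  =
      trans (cong (ℤ._+_ (f x)) (sum-filter-⊎ xs))
            (swap (f x) (sumℤ (map f (filter Q? xs))) _)
      where
      swap : ∀ a b c → a ℤ.+ (b ℤ.+ c) ≡ b ℤ.+ (a ℤ.+ c)
      swap = solve-∀
    ... | no _   | no _   | no _   = sum-filter-⊎ xs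
    ... | yes _  | yes q  | yes r  = ⊥-elim (Q⇒¬R q r)
    ... | yes p  | no ¬q  | no ¬r  = ⊥-elim ([ ¬q , ¬r ] (to P⇔Q⊎R p))
    ... | no ¬p  | yes q  | _      = ⊥-elim (¬p (from P⇔Q⊎R (inj₁ q)))
    ... | no ¬p  | no _   | yes r  = ⊥-elim (¬p (from P⇔Q⊎R (inj₂ r)))

i≡-i⇒i≡0 : ∀ {x} → x ≡ - x → x ≡ + 0
i≡-i⇒i≡0 {+ zero}   _  = refl
i≡-i⇒i≡0 {+ suc _}  ()
i≡-i⇒i≡0 { -[1+ _ ]} ()

SameSign : ℤ → ℤ → Set
SameSign x y = (+ 0 ℤ.< x × + 0 ℤ.< y) ⊎ (x ℤ.< + 0 × y ℤ.< + 0)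

sameSign? : ∀ x y → Dec (SameSign x y)
sameSign? x y =
  ((+ 0 ℤ.<? x) ×-dec (+ 0 ℤ.<? y)) ⊎-dec ((x ℤ.<? + 0) ×-dec (y ℤ.<? + 0))

neg-cancel-sameSign : ∀ {x y} → SameSign (- x) (- y) → SameSign x y
neg-cancel-sameSign (inj₁ (p , q)) = inj₂ (ℤP.neg-cancel-< p , ℤP.neg-cancel-< q)
neg-cancel-sameSign (inj₂ (p , q)) = inj₁ (ℤP.neg-cancel-< p , ℤP.neg-cancel-< q)

0<i⇒0<pos : ∀ {x} → + 0 ℤ.< x → 0 ℕ.< pos x
0<i⇒0<pos {+ suc _}  _           = ℕ.z<s
0<i⇒0<pos {+ zero}   (ℤ.+<+ ())

i<0⇒0<neg : ∀ {x} → x ℤ.< + 0 → 0 ℕ.< neg x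
i<0⇒0<neg { -[1+ _ ]} _           = ℕ.z<s
i<0⇒0<neg {+ _}       (ℤ.+<+ ())

module _ {n : ℕ} where

  -- Defs builds edges n from a local list function that cannot be named
  -- here, so its type is left to unification within the mutual block.
  mutual
    ∈-edges : (e : Edge n) → e ∈ edges n
    ∈-edges ((u , v) , u<v) =
      ∈-concatMap⁺ _ (lose (∈-allFin u)
        (∈-concatMap⁺ _ (lose (∈-allFin v) (∈-pick u<v))))

    ∈-pick : ∀ {u v : Fin n} (u<v : u < v) → ((u , v) , u<v) ∈ _
    ∈-pick {u} {v} u<v with u FinP.<? v
    ... | yes u<v′ = here (cong ((u , v) ,_) (FinP.<-irrelevant u<v u<v′))
    ... | no u≮v   = ⊥-elim (u≮v u<v)

  edge-≡ : ∀ {e f : Edge n} → src e ≡ src f → tgt e ≡ tgt f → e ≡ f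
  edge-≡ {(u , v) , l} {(.u , .v) , l′} refl refl =
    cong ((u , v) ,_) (FinP.<-irrelevant l l′)

  ∃-edge? : ∀ {P : Pred (Edge n) 0ℓ} → Decidable P → Dec (Σ (Edge n) P)
  ∃-edge? P? = map′ satisfied (λ (e , pe) → lose (∈-edges e) pe) (any? P? (edges n))

  nonIntersecting? : (e f : Edge n) → Dec (NonIntersecting e f)
  nonIntersecting? e f =
    ¬? (src e FinP.≟ src f) ×-dec ¬? (src e FinP.≟ tgt f) ×-dec
    ¬? (tgt e FinP.≟ src f) ×-dec ¬? (tgt e FinP.≟ tgt f) ×-dec
    ¬? ((src e FinP.<? src f ×-dec src f FinP.<? tgt e ×-dec tgt e FinP.<? tgt f)
        ⊎-dec (src f FinP.<? src e ×-dec src e FinP.<? tgt f ×-dec tgt f FinP.<? tgt e))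

  nonIntersecting-side-by-side : ∀ {e f : Edge n} → tgt e < src f → NonIntersecting e f
  nonIntersecting-side-by-side {e} {f} te<sf =
    FinP.<⇒≢ se<sf , FinP.<⇒≢ (FinP.<-trans se<sf (proj₂ f)) ,
    FinP.<⇒≢ te<sf , FinP.<⇒≢ (FinP.<-trans te<sf (proj₂ f)) ,
    [ (λ (_ , sf<te , _) → FinP.<-asym te<sf sf<te) , (λ (sf<se , _) → FinP.<-asym se<sf sf<se) ]
    where
    se<sf : src e < src f
    se<sf = FinP.<-trans (proj₂ e) te<sf

  nonIntersecting-nested : ∀ {e f : Edge n} → src e < src f → tgt f < tgt e →
                           NonIntersecting e f
  nonIntersecting-nested {e} {f} se<sf tf<te =
    FinP.<⇒≢ se<sf , FinP.<⇒≢ (FinP.<-trans se<sf (proj₂ f)) ,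
    (FinP.<⇒≢ sf<te ∘ sym) , (FinP.<⇒≢ tf<te ∘ sym) ,
    [ (λ (_ , _ , te<tf) → FinP.<-asym te<tf tf<te) , (λ (sf<se , _) → FinP.<-asym se<sf sf<se) ]
    where
    sf<te : src f < tgt e
    sf<te = FinP.<-trans (proj₂ f) tf<te

  var*var∣ : ∀ (α : Monomial n) {e f} → ¬ src e ≡ src f → 0 ℕ.< α e → 0 ℕ.< α f →
             (var e *ᵐ var f) ∣ᵐ α
  var*var∣ α {e} {f} src≢ 0<αe 0<αf g with e ≟E g | f ≟E g
  ... | yes (s , _) | yes (s′ , _) = ⊥-elim (src≢ (trans s (sym s′)))
  ... | yes (s , t) | no _         = subst (λ h → 1 ℕ.≤ α h) (edge-≡ s t) 0<αe
  ... | no _        | yes (s , t)  = subst (λ h → 1 ℕ.≤ α h) (edge-≡ s t) 0<αf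
  ... | no _        | no _         = z≤n

  Balanced : Vec2 n → Set
  Balanced γ = ∀ w → sumℤ (map γ (filter (incident? w) (edges n))) ≡ + 0

  SignClassesIntersect : Vec2 n → Set
  SignClassesIntersect γ = ∀ {e f} → NonIntersecting e f → ¬ SameSign (γ e) (γ f)

  MinimalTarget : Vec2 n → Edge n → Set
  MinimalTarget γ e = ∀ f → ¬ γ f ≡ + 0 → tgt e ≤ tgt f

  negate : Vec2 n → Vec2 n
  negate γ = -_ ∘ γ

  balanced-negate : ∀ {γ} → Balanced γ → Balanced (negate γ)
  balanced-negate {γ} bal w =
    trans (sum-neg γ (filter (incident? w) (edges n))) (cong -_ (bal w))

  signClassesIntersect-negate : ∀ {γ} → SignClassesIntersect γ →
                                SignClassesIntersect (negate γ)
  signClassesIntersect-negate sci e∦f = sci e∦f ∘ neg-cancel-sameSign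

  minimalTarget-negate : ∀ {γ e} → MinimalTarget γ e → MinimalTarget (negate γ) e
  minimalTarget-negate min f γf≢0 = min f (γf≢0 ∘ cong -_)

  minimal-target-support : ∀ γ {e} → ¬ γ e ≡ + 0 →
                           Σ[ e* ∈ Edge n ] (¬ γ e* ≡ + 0 × MinimalTarget γ e*)
  minimal-target-support γ {e} γe≢0 =
    e* , argmin-all (toℕ ∘ tgt) {P = λ f → ¬ γ f ≡ + 0} γe≢0 (all-filter support? (edges n)) ,
    minimal
    where
    support? : Decidable (λ f → ¬ γ f ≡ + 0)
    support? f = ¬? (γ f ℤ.≟ + 0)
    e* : Edge n
    e* = argmin (toℕ ∘ tgt) e (filter support? (edges n))
    minimal : MinimalTarget γ e*
    minimal f γf≢0 = All.lookup (f[argmin]≤f[xs] e (filter support? (edges n)))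
                                (∈-filter⁺ support? (∈-edges f) γf≢0)

  leftOf? : (k : ℕ) → Decidable (λ (e : Edge n) → toℕ (tgt e) ℕ.< k)
  leftOf? k e = toℕ (tgt e) ℕ.<? k

  rightOf? : (k : ℕ) → Decidable (λ (e : Edge n) → k ℕ.≤ toℕ (src e))
  rightOf? k e = k ℕ.≤? toℕ (src e)

  edgeSum : Vec2 n → ℤ
  edgeSum γ = sumℤ (map γ (edges n))

  leftSum : Vec2 n → ℕ → ℤ
  leftSum γ k = sumℤ (map γ (filter (leftOf? k) (edges n)))

  rightSum : Vec2 n → ℕ → ℤ
  rightSum γ k = sumℤ (map γ (filter (rightOf? k) (edges n)))

  cutDifference : Vec2 n → ℕ → ℤ
  cutDifference γ k = leftSum γ k ℤ.- rightSum γ k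

  module _ (γ : Vec2 n) where

    leftSum-0 : leftSum γ 0 ≡ + 0
    leftSum-0 = cong (sumℤ ∘ map γ)
      (filter-none (leftOf? 0) {edges n} (tabulate λ _ → ℕP.n≮0))

    rightSum-0 : rightSum γ 0 ≡ edgeSum γ
    rightSum-0 = cong (sumℤ ∘ map γ)
      (filter-all (rightOf? 0) {edges n} (tabulate λ _ → z≤n))

    leftSum-n : leftSum γ n ≡ edgeSum γ
    leftSum-n = cong (sumℤ ∘ map γ)
      (filter-all (leftOf? n) {edges n} (tabulate λ {e} _ → FinP.toℕ<n (tgt e)))

    rightSum-n : rightSum γ n ≡ + 0
    rightSum-n = cong (sumℤ ∘ map γ)
      (filter-none (rightOf? n) {edges n}
        (tabulate λ {e} _ → ℕP.<⇒≱ (FinP.toℕ<n (src e))))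

  module _ (γ : Vec2 n) (w : Fin n) where

    into? : Decidable (λ (e : Edge n) → w ≡ tgt e)
    into? e = w FinP.≟ tgt e

    outOf? : Decidable (λ (e : Edge n) → w ≡ src e)
    outOf? e = w FinP.≟ src e

    intoSum : ℤ
    intoSum = sumℤ (map γ (filter into? (edges n)))

    outOfSum : ℤ
    outOfSum = sumℤ (map γ (filter outOf? (edges n)))

    leftSum-suc : leftSum γ (suc (toℕ w)) ≡ leftSum γ (toℕ w) ℤ.+ intoSum
    leftSum-suc = sum-filter-⊎ γ (leftOf? (suc (toℕ w))) (leftOf? (toℕ w)) into?
      (mk⇔ (Sum.map₂ (FinP.toℕ-injective ∘ sym) ∘ ℕP.m<1+n⇒m<n∨m≡n)
           [ ℕP.m<n⇒m<1+n , (λ { refl → ℕP.n<1+n (toℕ w) }) ])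
      (λ { t<w refl → ℕP.<-irrefl refl t<w })
      (edges n)

    rightSum-suc : rightSum γ (toℕ w) ≡ rightSum γ (suc (toℕ w)) ℤ.+ outOfSum
    rightSum-suc = sum-filter-⊎ γ (rightOf? (toℕ w)) (rightOf? (suc (toℕ w))) outOf?
      (mk⇔ (Sum.map₂ FinP.toℕ-injective ∘ ℕP.m≤n⇒m<n∨m≡n)
           [ ℕP.<⇒≤ , (λ { refl → ℕP.≤-refl }) ])
      (λ { w<s refl → ℕP.<-irrefl refl w<s })
      (edges n)

    vertexSum-split :
      sumℤ (map γ (filter (incident? w) (edges n))) ≡ outOfSum ℤ.+ intoSum
    vertexSum-split = sum-filter-⊎ γ (incident? w) outOf? into? (mk⇔ id id)
      (λ {e} w≡s w≡t → FinP.<-irrefl (trans (sym w≡s) w≡t) (proj₂ e))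
      (edges n)

    cutDifference-suc : Balanced γ →
                        cutDifference γ (suc (toℕ w)) ≡ cutDifference γ (toℕ w)
    cutDifference-suc bal = begin
      leftSum γ (suc k) ℤ.- rightSum γ (suc k)
        ≡⟨ cong (λ l → l ℤ.- rightSum γ (suc k)) leftSum-suc ⟩
      (leftSum γ k ℤ.+ intoSum) ℤ.- rightSum γ (suc k)
        ≡⟨ regroup (leftSum γ k) intoSum (rightSum γ (suc k)) outOfSum ⟩
      (leftSum γ k ℤ.- (rightSum γ (suc k) ℤ.+ outOfSum)) ℤ.+ (outOfSum ℤ.+ intoSum)
        ≡⟨ cong₂ (λ r d → (leftSum γ k ℤ.- r) ℤ.+ d)
                 (sym rightSum-suc) (trans (sym vertexSum-split) (bal w)) ⟩
      cutDifference γ k ℤ.+ + 0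
        ≡⟨ ℤP.+-identityʳ _ ⟩
      cutDifference γ k ∎
      where
      open ≡-Reasoning
      k : ℕ
      k = toℕ w
      regroup : ∀ a b c d → (a ℤ.+ b) ℤ.- c ≡ (a ℤ.- (c ℤ.+ d)) ℤ.+ (d ℤ.+ b)
      regroup = solve-∀

  cutDifference-constant : ∀ {γ} → Balanced γ → ∀ {k} → k ℕ.≤ n →
                           cutDifference γ k ≡ cutDifference γ 0
  cutDifference-constant bal {zero}      _   = refl
  cutDifference-constant {γ} bal {suc k} k<n =
    trans (subst (λ j → cutDifference γ (suc j) ≡ cutDifference γ j)
                 (FinP.toℕ-fromℕ< k<n) (cutDifference-suc γ (fromℕ< k<n) bal))
          (cutDifference-constant bal (ℕP.<⇒≤ k<n))

  balanced⇒edgeSum≡0 : ∀ {γ} → Balanced γ → edgeSum γ ≡ + 0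
  balanced⇒edgeSum≡0 {γ} bal = i≡-i⇒i≡0 (begin
    edgeSum γ                      ≡⟨ sym (ℤP.+-identityʳ _) ⟩
    edgeSum γ ℤ.- + 0              ≡⟨ cong₂ ℤ._-_ (leftSum-n γ) (rightSum-n γ) ⟨
    cutDifference γ n              ≡⟨ cutDifference-constant bal ℕP.≤-refl ⟩
    cutDifference γ 0              ≡⟨ cong₂ ℤ._-_ (leftSum-0 γ) (rightSum-0 γ) ⟩
    + 0 ℤ.- edgeSum γ              ≡⟨ ℤP.+-identityˡ _ ⟩
    - edgeSum γ                    ∎)
    where open ≡-Reasoning

  balanced⇒leftSum≡rightSum : ∀ {γ} → Balanced γ → ∀ {k} → k ℕ.≤ n →
                              leftSum γ k ≡ rightSum γ k
  balanced⇒leftSum≡rightSum {γ} bal {k} k≤n = ℤP.i-j≡0⇒i≡j _ _ (begin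
    cutDifference γ k              ≡⟨ cutDifference-constant bal k≤n ⟩
    cutDifference γ 0              ≡⟨ cong₂ ℤ._-_ (leftSum-0 γ) (rightSum-0 γ) ⟩
    + 0 ℤ.- edgeSum γ              ≡⟨ cong (ℤ._-_ (+ 0)) (balanced⇒edgeSum≡0 bal) ⟩
    + 0                            ∎)
    where open ≡-Reasoning

  support-at-source : ∀ {γ e f} → MinimalTarget γ e → Incident (src e) f →
                      ¬ γ f ≡ + 0 → ¬ f ≡ e → src e ≡ src f × tgt e < tgt f
  support-at-source {e = e} {f} min (inj₂ se≡tf) γf≢0 _ =
    ⊥-elim (ℕP.<⇒≱ (proj₂ e) (subst (tgt e ≤_) (sym se≡tf) (min f γf≢0)))
  support-at-source {e = e} {f} min (inj₁ se≡sf) γf≢0 f≢e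
    with ℕP.m≤n⇒m<n∨m≡n (min f γf≢0)
  ... | inj₁ te<tf = se≡sf , te<tf
  ... | inj₂ te≡tf = ⊥-elim (f≢e (edge-≡ (sym se≡sf) (FinP.toℕ-injective (sym te≡tf))))

  module _ {γ : Vec2 n} (bal : Balanced γ) (sci : SignClassesIntersect γ) where

    opposite-sign-into-min-target-from-right : ∀ {e g} → MinimalTarget γ e →
      + 0 ℤ.< γ e → tgt g ≡ tgt e → src e < src g → γ g ℤ.< + 0 → ⊥
    opposite-sign-into-min-target-from-right {e} {g} min 0<γe tg≡te se<sg γg<0 =
      ℤP.<-irrefl (sym (bal (src e)))
        (sum-pos γ (All.map nonneg (all-filter (incident? (src e)) (edges n)))
                   (∈-filter⁺ (incident? (src e)) (∈-edges e) (inj₁ refl)) 0<γe)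
      where
      -- A negative edge at src e would leave it beyond tgt e, so nest around g.
      nonneg : ∀ {f} → Incident (src e) f → + 0 ℤ.≤ γ f
      nonneg {f} se∈f with γ f ℤ.<? + 0
      ... | no γf≮0  = ℤP.≮⇒≥ γf≮0
      ... | yes γf<0 =
        let se≡sf , te<tf = support-at-source min se∈f (ℤP.<⇒≢ γf<0)
              (λ f≡e → ℤP.<-asym γf<0 (subst (λ h → + 0 ℤ.< γ h) (sym f≡e) 0<γe))
        in ⊥-elim (sci (nonIntersecting-nested {f} {g} (subst (_< src g) se≡sf se<sg)
                                                       (subst (_< tgt f) (sym tg≡te) te<tf))
                       (inj₂ (γf<0 , γg<0)))

  opposite-sign-into-min-target : ∀ {γ e g} → Balanced γ → SignClassesIntersect γ →
    MinimalTarget γ e → + 0 ℤ.< γ e → tgt g ≡ tgt e → γ g ℤ.< + 0 → ⊥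
  opposite-sign-into-min-target {γ} {e} {g} bal sci min 0<γe tg≡te γg<0
    with FinP.<-cmp (src e) (src g)
  ... | tri< se<sg _ _ =
    opposite-sign-into-min-target-from-right bal sci min 0<γe tg≡te se<sg γg<0
  ... | tri≈ _ se≡sg _ =
    ℤP.<-asym γg<0 (subst (λ h → + 0 ℤ.< γ h) (edge-≡ se≡sg (sym tg≡te)) 0<γe)
  ... | tri> _ _ sg<se =
    opposite-sign-into-min-target-from-right
      (balanced-negate bal) (signClassesIntersect-negate {γ} sci)
      (minimalTarget-negate {γ} {g} (λ f γf≢0 → subst (_≤ tgt f) (sym tg≡te) (min f γf≢0)))
      (ℤP.neg-mono-< γg<0) (sym tg≡te) sg<se (ℤP.neg-mono-< 0<γe)

  min-target-not-positive : ∀ {γ e} → Balanced γ → SignClassesIntersect γ →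
                            MinimalTarget γ e → ¬ (+ 0 ℤ.< γ e)
  min-target-not-positive {γ} {e} bal sci min 0<γe =
    ℤP.<⇒≱ left-positive
      (subst (ℤ._≤ + 0) (sym (balanced⇒leftSum≡rightSum bal (FinP.toℕ<n (tgt e))))
             right-nonpositive)
    where
    k : ℕ
    k = suc (toℕ (tgt e))

    left-nonneg : ∀ {f} → toℕ (tgt f) ℕ.< k → + 0 ℤ.≤ γ f
    left-nonneg {f} tf<k with γ f ℤ.<? + 0
    ... | no γf≮0  = ℤP.≮⇒≥ γf≮0
    ... | yes γf<0 = ⊥-elim (opposite-sign-into-min-target bal sci min 0<γe
      (FinP.≤-antisym (ℕP.≤-pred tf<k) (min f (ℤP.<⇒≢ γf<0))) γf<0)

    right-nonpos : ∀ {f} → k ℕ.≤ toℕ (src f) → γ f ℤ.≤ + 0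
    right-nonpos {f} te<sf with + 0 ℤ.<? γ f
    ... | no 0≮γf  = ℤP.≮⇒≥ 0≮γf
    ... | yes 0<γf =
      ⊥-elim (sci (nonIntersecting-side-by-side {e} {f} te<sf) (inj₁ (0<γe , 0<γf)))

    left-positive : + 0 ℤ.< leftSum γ k
    left-positive = sum-pos γ (All.map left-nonneg (all-filter (leftOf? k) (edges n)))
      (∈-filter⁺ (leftOf? k) (∈-edges e) (ℕP.n<1+n _)) 0<γe

    right-nonpositive : rightSum γ k ℤ.≤ + 0
    right-nonpositive =
      sum-nonpos γ (All.map right-nonpos (all-filter (rightOf? k) (edges n)))

  signClassesIntersect⇒≡0 : ∀ {γ} → Balanced γ → SignClassesIntersect γ →
                            ∀ e → γ e ≡ + 0
  signClassesIntersect⇒≡0 {γ} bal sci e =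
    decidable-stable (γ e ℤ.≟ + 0) (no-min-target-support ∘ minimal-target-support γ)
    where
    no-min-target-support : ¬ (Σ[ e* ∈ Edge n ] (¬ γ e* ≡ + 0 × MinimalTarget γ e*))
    no-min-target-support (e* , γe*≢0 , min) with ℤP.<-cmp (γ e*) (+ 0)
    ... | tri< γe*<0 _ _ =
      min-target-not-positive (balanced-negate bal) (signClassesIntersect-negate {γ} sci)
        (minimalTarget-negate {γ} {e*} min) (ℤP.neg-mono-< γe*<0)
    ... | tri≈ _ γe*≡0 _ = γe*≢0 γe*≡0
    ... | tri> _ _ 0<γe* = min-target-not-positive bal sci min 0<γe*

sameSign⇒divides : ∀ {n} (γ : Vec2 n) {e f} →
                   NonIntersecting e f → SameSign (γ e) (γ f) →
                   ((var e *ᵐ var f) ∣ᵐ (γ ⁺)) ⊎ ((var e *ᵐ var f) ∣ᵐ (γ ⁻))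
sameSign⇒divides γ e∦f = Sum.map
  (λ (p , q) → var*var∣ (γ ⁺) (proj₁ e∦f) (0<i⇒0<pos p) (0<i⇒0<pos q))
  (λ (p , q) → var*var∣ (γ ⁻) (proj₁ e∦f) (i<0⇒0<neg p) (i<0⇒0<neg q))

proposition4p2 : (n k : ℕ) (z : Fin n → Fin k) (γ : Vec2 n) →
    InKernel n k z γ → ¬ (∀ e → γ e ≡ + 0) →
    Σ[ e ∈ Edge n ] Σ[ f ∈ Edge n ] (NonIntersecting e f ×
      (((var e *ᵐ var f) ∣ᵐ (γ ⁺)) ⊎ ((var e *ᵐ var f) ∣ᵐ (γ ⁻))))
proposition4p2 n k z γ (balanced , _) γ≢0
  with ∃-edge? (λ e → ∃-edge? (λ f → nonIntersecting? e f ×-dec sameSign? (γ e) (γ f)))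
... | yes (e , f , e∦f , same) = e , f , e∦f , sameSign⇒divides γ e∦f same
... | no ∄pair =
  ⊥-elim (γ≢0 (signClassesIntersect⇒≡0 balanced
                 (λ e∦f same → ∄pair (_ , _ , e∦f , same))))
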